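{- Let $q>2$ be a prime power, $k$ a positive integer, and $b_1,\dots,b_k\in\mathbb{F}_q$. For $2\le\ell\le k$ let $\Phi_\ell:\mathbb{F}_q^\ell\to\mathbb{F}_q^{\ell-1}$, $\Phi_\ell(e_1,\dots,e_\ell)=((e_2-e_1)^{q-2},\dots,(e_\ell-e_1)^{q-2})$, let $\Phi^{i-1}:=\Phi_{k-i+2}\circ\cdots\circ\Phi_k$ for $1\le i\le k$ ($\Phi^0$ the identity), and let $a_i$ be the first entry of $\Phi^{i-1}(b_1,\dots,b_k)$, so $(a_1,\dots,a_k)=G(b_1,\dots,b_k)$. Then, as permutations of $\mathbb{P}^1(\mathbb{F}_q)=\mathbb{F}_q\cup\{\infty\}$, $$(b_1,\infty)\circ(b_2,\infty)\circ\cdots\circ(b_k,\infty)=\mu(x)\circ x^{q-2}\circ(x-a_k)\circ x^{q-2}\circ(x-a_{k-1})\circ\cdots\circ x^{q-2}\circ(x-a_1),$$ where $\mu(x):=(x+a_1)\circ x^{ -1}\circ(x+a_2)\circ x^{ -1}\circ\cdots\circ(x+a_k)\circ x^{ -1}$ is a degree-one rational function in $\mathbb{F}_q(x)$.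
   Context: $f\circ g$ means apply $g$ first. Degree-one rational functions act on $\mathbb{P}^1(\mathbb{F}_q)$ in the usual way ($x^{ -1}$ swaps $0$ and $\infty$; $x\pm a$ fixes $\infty$). $x^{q-2}$ acts by $c\mapsto c^{q-2}$ on $\mathbb{F}_q$ (so $0\mapsto0$) and fixes $\infty$. $(b,\infty)$ is the transposition swapping $b$ and $\infty$. For $c\in\mathbb{F}_q$, $c^{q-2}$ is the field power. -}

module Defs where

open import Level using (0ℓ)
open import Data.Nat using (ℕ; zero; suc; _∸_)
open import Data.Fin using (Fin)
open import Data.Maybe using (Maybe; just; nothing)
open import Data.Vec using (Vec; []; _∷_; map)
open import Data.Product using (Σ; _×_; _,_)
open import Function using (_∘_; id)
open import Function.Bundles using (_↔_)
open import Relation.Nullary using (¬_; yes; no)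
open import Relation.Binary.PropositionalEquality using (_≡_)
open import Relation.Binary.Definitions using (DecidableEquality)
open import Algebra.Structures using (IsCommutativeRing)

record FiniteField (q : ℕ) : Set₁ where
  infixl 7 _*_
  infixl 6 _+_ _-_
  field
    Carrier : Set
    _+_ _*_ : Carrier → Carrier → Carrier
    -_      : Carrier → Carrier
    0# 1#   : Carrier
    isCommutativeRing : IsCommutativeRing _≡_ _+_ _*_ -_ 0# 1#
    _≟_     : DecidableEquality Carrier
    0≢1     : ¬ (0# ≡ 1#)
    _⁻¹     : Carrier → Carrier
    inverse : ∀ x → ¬ (x ≡ 0#) → x * (x ⁻¹) ≡ 1#
    0⁻¹     : 0# ⁻¹ ≡ 0#
    card    : Fin q ↔ Carrier

  _-_ : Carrier → Carrier → Carrier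
  x - y = x + (- y)

  _^_ : Carrier → ℕ → Carrier
  x ^ zero  = 1#
  x ^ suc n = x * (x ^ n)

  P1 : Set
  P1 = Maybe Carrier

  ∞ : P1
  ∞ = nothing

  transp : Carrier → P1 → P1
  transp b nothing = just b
  transp b (just c) with c ≟ b
  ... | yes _ = nothing
  ... | no  _ = just c

  powq2 : P1 → P1
  powq2 nothing  = nothing
  powq2 (just c) = just (c ^ (q ∸ 2))

  add : Carrier → P1 → P1
  add a nothing  = nothing
  add a (just c) = just (c + a)

  sub : Carrier → P1 → P1
  sub a nothing  = nothing
  sub a (just c) = just (c - a)

  inv : P1 → P1
  inv nothing  = just 0#
  inv (just c) with c ≟ 0#
  ... | yes _ = nothing
  ... | no  _ = just (c ⁻¹)

  mobius : Carrier → Carrier → Carrier → Carrier → P1 → P1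
  mobius α β γ δ nothing with γ ≟ 0#
  ... | yes _ = nothing
  ... | no  _ = just (α * (γ ⁻¹))
  mobius α β γ δ (just c) with (γ * c + δ) ≟ 0#
  ... | yes _ = nothing
  ... | no  _ = just ((α * c + β) * ((γ * c + δ) ⁻¹))

  Φ : ∀ {ℓ} → Vec Carrier (suc ℓ) → Vec Carrier ℓ
  Φ (e₁ ∷ es) = map (λ e → (e - e₁) ^ (q ∸ 2)) es

  G : ∀ {k} → Vec Carrier k → Vec Carrier k
  G []         = []
  G (e₁ ∷ es) = e₁ ∷ G (Φ (e₁ ∷ es))

  transps : ∀ {k} → Vec Carrier k → P1 → P1
  transps []       = id
  transps (b ∷ bs) = transp b ∘ transps bs

  μ : ∀ {k} → Vec Carrier k → P1 → P1
  μ []       = id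
  μ (a ∷ as) = add a ∘ inv ∘ μ as

  tailComp : ∀ {k} → Vec Carrier k → P1 → P1
  tailComp []       = id
  tailComp (a ∷ as) = tailComp as ∘ powq2 ∘ sub a

  DegreeOne : (P1 → P1) → Set
  DegreeOne f = Σ Carrier λ α → Σ Carrier λ β → Σ Carrier λ γ → Σ Carrier λ δ →
    ¬ (α * δ - β * γ ≡ 0#) × (∀ x → f x ≡ mobius α β γ δ x)

{-# OPTIONS --safe #-}

-- For q > 2 Fermat's little theorem gives x ^ (q - 2) = x⁻¹ on 𝔽_q, so ψ_b := x^(q-2) ∘ (x - b) fixes ∞
-- and sends c ∈ 𝔽_q to (c - b)⁻¹. Two facts about ψ_b drive the proof:
--   (x + b) ∘ x⁻¹ ∘ ψ_b = (b, ∞),   and   ψ_b ∘ (c, ∞) = (ψ_b c, ∞) ∘ ψ_b  (ψ_b is injective and fixes ∞).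
-- Hence (b₁,∞) ∘ ⋯ ∘ (b_k,∞) = (x + b₁) ∘ x⁻¹ ∘ ((ψ_{b₁} b₂,∞) ∘ ⋯ ∘ (ψ_{b₁} b_k,∞)) ∘ ψ_{b₁}, and the
-- middle factor is the same product for Φ_k(b), which is exactly the recursion defining G; induct on k.
-- μ has degree one because every factor (x + a) ∘ x⁻¹ is a Möbius transformation, and these compose.
module Submission where

open import Level using (0ℓ)
open import Data.Nat using (ℕ; zero; suc; _<_; _≤_; _∸_; s≤s)
open import Data.Nat.Properties using (<⇒≤; m<n⇒0<n∸m)
open import Data.Fin using (Fin; punchIn)
open import Data.Fin.Properties using (punchInᵢ≢i)
open import Data.Fin.Permutation using (Permutation)
open import Data.Maybe using (just; nothing)
import Data.Maybe as Maybe
open import Data.Vec using (Vec; []; _∷_)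
import Data.Vec as Vec
open import Data.Product using (_×_; _,_)
open import Data.Empty using (⊥-elim)
open import Function using (_∘_; id)
open import Function.Bundles using (_↔_; Inverse; mk↔ₛ′)
open import Function.Definitions using (Injective)
open import Function.Properties.Inverse using (↔-sym; ↔-trans)
open import Relation.Nullary using (¬_; yes; no)
open import Relation.Binary.PropositionalEquality
open import Algebra.Bundles using (CommutativeRing)
import Algebra.Properties.Group as GroupProperties
import Algebra.Properties.CommutativeMonoid.Sum as ProductProperties
import Algebra.Solver.Ring.NaturalCoefficients.Default as NaturalSolver
open import Defs

module _ {q : ℕ} (F : FiniteField q) where
  open FiniteField F
  open ≡-Reasoning

  commutativeRing : CommutativeRing 0ℓ 0ℓ
  commutativeRing = record { isCommutativeRing = isCommutativeRing }

  open CommutativeRing commutativeRing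
    using (+-assoc; +-identityˡ; +-identityʳ; -‿inverseˡ; *-assoc; *-comm; *-identityˡ; *-identityʳ;
           distribʳ; zeroˡ; zeroʳ; +-group; commutativeSemiring; *-commutativeMonoid)
  open GroupProperties +-group using (x∙y⁻¹≈ε⇒x≈y; x≈y⇒x∙y⁻¹≈ε; ∙-cancelʳ; ε⁻¹≈ε)
  open NaturalSolver commutativeSemiring using (solve; _:=_; _:+_; _:*_)
  open ProductProperties *-commutativeMonoid
    using (sum-cong-≗; sum-permute; sum-remove; sum-replicate-zero)
    renaming (sum to ∏; ∑-distrib-+ to ∏-distrib-*)

  _≢0 : Carrier → Set
  x ≢0 = ¬ (x ≡ 0#)

  x-y≡0⇒x≡y : ∀ {x y} → x - y ≡ 0# → x ≡ y
  x-y≡0⇒x≡y = x∙y⁻¹≈ε⇒x≈y _ _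

  x-z≡y-z⇒x≡y : ∀ b {x y} → x - b ≡ y - b → x ≡ y
  x-z≡y-z⇒x≡y b = ∙-cancelʳ (- b) _ _

  x-y+y≡x : ∀ x y → x - y + y ≡ x
  x-y+y≡x x y = begin
    x + - y + y    ≡⟨ +-assoc x (- y) y ⟩
    x + (- y + y)  ≡⟨ cong (x +_) (-‿inverseˡ y) ⟩
    x + 0#         ≡⟨ +-identityʳ x ⟩
    x              ∎

  1≢0 : 1# ≢0
  1≢0 = 0≢1 ∘ sym

  x*y≡1⇒x≢0 : ∀ {x y} → x * y ≡ 1# → x ≢0
  x*y≡1⇒x≢0 {x} {y} xy≡1 x≡0 = 0≢1 (begin
    0#     ≡⟨ zeroˡ y ⟨
    0# * y ≡⟨ cong (_* y) x≡0 ⟨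
    x * y  ≡⟨ xy≡1 ⟩
    1#     ∎)

  *-cancelˡ : ∀ {x y z} → x ≢0 → x * y ≡ x * z → y ≡ z
  *-cancelˡ {x} {y} {z} x≢0 xy≡xz = begin
    y              ≡⟨ *-identityˡ y ⟨
    1# * y         ≡⟨ cong (_* y) x⁻¹x≡1 ⟨
    x ⁻¹ * x * y   ≡⟨ *-assoc (x ⁻¹) x y ⟩
    x ⁻¹ * (x * y) ≡⟨ cong (x ⁻¹ *_) xy≡xz ⟩
    x ⁻¹ * (x * z) ≡⟨ *-assoc (x ⁻¹) x z ⟨
    x ⁻¹ * x * z   ≡⟨ cong (_* z) x⁻¹x≡1 ⟩
    1# * z         ≡⟨ *-identityˡ z ⟩
    z              ∎
    where
    x⁻¹x≡1 : x ⁻¹ * x ≡ 1#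
    x⁻¹x≡1 = trans (*-comm (x ⁻¹) x) (inverse x x≢0)

  *-≢0 : ∀ {x y} → x ≢0 → y ≢0 → (x * y) ≢0
  *-≢0 {x} x≢0 y≢0 xy≡0 = y≢0 (*-cancelˡ x≢0 (trans xy≡0 (sym (zeroʳ x))))

  ⁻¹-unique : ∀ {x y} → x * y ≡ 1# → x ⁻¹ ≡ y
  ⁻¹-unique {x} xy≡1 = *-cancelˡ (x*y≡1⇒x≢0 xy≡1) (trans (inverse x (x*y≡1⇒x≢0 xy≡1)) (sym xy≡1))

  ⁻¹-≢0 : ∀ {x} → x ≢0 → x ⁻¹ ≢0
  ⁻¹-≢0 {x} x≢0 = x*y≡1⇒x≢0 (trans (*-comm (x ⁻¹) x) (inverse x x≢0))

  ⁻¹-involutive : ∀ x → x ⁻¹ ⁻¹ ≡ x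
  ⁻¹-involutive x with x ≟ 0#
  ... | yes refl = trans (cong _⁻¹ 0⁻¹) 0⁻¹
  ... | no x≢0   = ⁻¹-unique (trans (*-comm (x ⁻¹) x) (inverse x x≢0))

  ⁻¹-injective : Injective _≡_ _≡_ _⁻¹
  ⁻¹-injective {x} {y} x⁻¹≡y⁻¹ = begin
    x        ≡⟨ ⁻¹-involutive x ⟨
    x ⁻¹ ⁻¹  ≡⟨ cong _⁻¹ x⁻¹≡y⁻¹ ⟩
    y ⁻¹ ⁻¹  ≡⟨ ⁻¹-involutive y ⟩
    y        ∎

  ⁻¹-distrib-* : ∀ {x y} → x ≢0 → y ≢0 → (x * y) ⁻¹ ≡ x ⁻¹ * y ⁻¹
  ⁻¹-distrib-* {x} {y} x≢0 y≢0 = ⁻¹-unique (begin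
    x * y * (x ⁻¹ * y ⁻¹)    ≡⟨ solve 4 (λ x y x′ y′ → x :* y :* (x′ :* y′) := x :* x′ :* (y :* y′))
                                       refl x y (x ⁻¹) (y ⁻¹) ⟩
    x * x ⁻¹ * (y * y ⁻¹)    ≡⟨ cong₂ _*_ (inverse x x≢0) (inverse y y≢0) ⟩
    1# * 1#                  ≡⟨ *-identityˡ 1# ⟩
    1#                       ∎)

  ∏-const : ∀ n y → ∏ {n} (λ _ → y) ≡ y ^ n
  ∏-const zero    y = refl
  ∏-const (suc n) y = cong (y *_) (∏-const n y)

  ∏-≢0 : ∀ {n} (f : Fin n → Carrier) → (∀ i → f i ≢0) → ∏ f ≢0
  ∏-≢0 {zero}  f f≢0 = 1≢0
  ∏-≢0 {suc n} f f≢0 = *-≢0 (f≢0 Fin.zero) (∏-≢0 (f ∘ Fin.suc) (f≢0 ∘ Fin.suc))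

  ∏-single : ∀ {n} (f : Fin n → Carrier) i → (∀ j → j ≢ i → f j ≡ 1#) → ∏ f ≡ f i
  ∏-single {suc n} f i f≡1 = begin
    ∏ f                                   ≡⟨ sum-remove f ⟩
    f i * ∏ (f ∘ punchIn i)               ≡⟨ cong (f i *_) (sum-cong-≗ (λ j → f≡1 _ (punchInᵢ≢i i j))) ⟩
    f i * ∏ {n} (λ _ → 1#)                ≡⟨ cong (f i *_) (sum-replicate-zero n) ⟩
    f i * 1#                              ≡⟨ *-identityʳ (f i) ⟩
    f i                                   ∎

  0^-≡0 : ∀ {m} → 0 < m → 0# ^ m ≡ 0#
  0^-≡0 {suc m} _ = zeroˡ (0# ^ m)

  ^-peel₂ : ∀ y {m} → 2 ≤ m → y ^ m ≡ y * (y * y ^ (m ∸ 2))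
  ^-peel₂ y (s≤s (s≤s _)) = refl

  element : Fin q → Carrier
  element = Inverse.to card

  ∏-element-reindex : (π : Carrier ↔ Carrier) (f : Carrier → Carrier) →
                      ∏ (f ∘ element) ≡ ∏ (f ∘ Inverse.to π ∘ element)
  ∏-element-reindex π f = begin
    ∏ (f ∘ element)                         ≡⟨ sum-permute (f ∘ element) π′ ⟩
    ∏ (f ∘ element ∘ index ∘ π.to ∘ element) ≡⟨ sum-cong-≗ {x = f ∘ element ∘ index ∘ π.to ∘ element}
                                                          (λ i → cong f (Inverse.strictlyInverseˡ card _)) ⟩
    ∏ (f ∘ π.to ∘ element)                  ∎
    where
    module π = Inverse π
    index : Carrier → Fin q
    index = Inverse.from card
    π′ : Permutation q q
    π′ = ↔-trans card (↔-trans π (↔-sym card))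

  scaling : ∀ {y} → y ≢0 → Carrier ↔ Carrier
  scaling {y} y≢0 = mk↔ₛ′ (y *_) (y ⁻¹ *_) (cancel y (y ⁻¹) yy⁻¹≡1) (cancel (y ⁻¹) y y⁻¹y≡1)
    where
    yy⁻¹≡1 : y * y ⁻¹ ≡ 1#
    yy⁻¹≡1 = inverse y y≢0
    y⁻¹y≡1 : y ⁻¹ * y ≡ 1#
    y⁻¹y≡1 = trans (*-comm (y ⁻¹) y) yy⁻¹≡1
    cancel : ∀ a b → a * b ≡ 1# → ∀ c → a * (b * c) ≡ c
    cancel a b ab≡1 c = trans (sym (*-assoc a b c)) (trans (cong (_* c) ab≡1) (*-identityˡ c))

  nonzeroPart : Carrier → Carrier
  nonzeroPart z with z ≟ 0#
  ... | yes _ = 1#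
  ... | no  _ = z

  atZero : Carrier → Carrier → Carrier
  atZero y z with z ≟ 0#
  ... | yes _ = y
  ... | no  _ = 1#

  nonzeroPart-≢0 : ∀ z → nonzeroPart z ≢0
  nonzeroPart-≢0 z with z ≟ 0#
  ... | yes _  = 1≢0
  ... | no z≢0 = z≢0

  nonzeroPart-0 : ∀ {z} → z ≡ 0# → nonzeroPart z ≡ 1#
  nonzeroPart-0 {z} z≡0 with z ≟ 0#
  ... | yes _  = refl
  ... | no z≢0 = ⊥-elim (z≢0 z≡0)

  nonzeroPart-≢0-id : ∀ {z} → z ≢0 → nonzeroPart z ≡ z
  nonzeroPart-≢0-id {z} z≢0 with z ≟ 0#
  ... | yes z≡0 = ⊥-elim (z≢0 z≡0)
  ... | no _    = refl

  -- The factor atZero y z repairs the one place, z = 0, where nonzeroPart is not multiplicative.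
  nonzeroPart-*ˡ : ∀ {y} → y ≢0 → ∀ z → nonzeroPart (y * z) * atZero y z ≡ y * nonzeroPart z
  nonzeroPart-*ˡ {y} y≢0 z with z ≟ 0#
  ... | yes z≡0 = begin
    nonzeroPart (y * z) * y ≡⟨ cong (_* y) (nonzeroPart-0 (trans (cong (y *_) z≡0) (zeroʳ y))) ⟩
    1# * y                  ≡⟨ *-comm 1# y ⟩
    y * 1#                  ∎
  ... | no z≢0 = begin
    nonzeroPart (y * z) * 1# ≡⟨ *-identityʳ _ ⟩
    nonzeroPart (y * z)      ≡⟨ nonzeroPart-≢0-id (*-≢0 y≢0 z≢0) ⟩
    y * z                    ∎

  ∏-atZero : ∀ y → ∏ (atZero y ∘ element) ≡ y
  ∏-atZero y = begin
    ∏ (atZero y ∘ element)         ≡⟨ ∏-single (atZero y ∘ element) i₀ atZero≡1 ⟩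
    atZero y (element i₀)          ≡⟨ cong (atZero y) (Inverse.strictlyInverseˡ card 0#) ⟩
    atZero y 0#                    ≡⟨ atZero-0 ⟩
    y                              ∎
    where
    i₀ : Fin q
    i₀ = Inverse.from card 0#
    atZero-0 : atZero y 0# ≡ y
    atZero-0 with 0# ≟ 0#
    ... | yes _  = refl
    ... | no 0≢0 = ⊥-elim (0≢0 refl)
    atZero≡1 : ∀ j → j ≢ i₀ → atZero y (element j) ≡ 1#
    atZero≡1 j j≢i₀ with element j ≟ 0#
    ... | yes j↦0 = ⊥-elim (j≢i₀ (trans (sym (Inverse.strictlyInverseʳ card j)) (cong (Inverse.from card) j↦0)))
    ... | no _    = refl

  -- Multiplication by y permutes the field, so it leaves P = ∏ nonzeroPart unchanged; factorwise it
  -- multiplies P by y ^ q, up to the factor y lost at z = 0.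
  fermat : ∀ {y} → y ≢0 → y ^ q ≡ y
  fermat {y} y≢0 = *-cancelˡ (∏-≢0 (nonzeroPart ∘ element) (nonzeroPart-≢0 ∘ element)) (begin
    P * y ^ q                                                     ≡⟨ *-comm P (y ^ q) ⟩
    y ^ q * P                                                     ≡⟨ cong (_* P) (∏-const q y) ⟨
    ∏ {q} (λ _ → y) * P                                           ≡⟨ ∏-distrib-* (λ _ → y) (nonzeroPart ∘ element) ⟨
    ∏ (λ i → y * nonzeroPart (element i))                         ≡⟨ sum-cong-≗ (nonzeroPart-*ˡ y≢0 ∘ element) ⟨
    ∏ (λ i → nonzeroPart (y * element i) * atZero y (element i))  ≡⟨ ∏-distrib-* (nonzeroPart ∘ (y *_) ∘ element)
                                                                                   (atZero y ∘ element) ⟩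
    ∏ (nonzeroPart ∘ (y *_) ∘ element) * ∏ (atZero y ∘ element)   ≡⟨ cong₂ _*_ (∏-element-reindex (scaling y≢0) nonzeroPart)
                                                                                 (sym (∏-atZero y)) ⟨
    P * y                                                         ∎)
    where
    P : Carrier
    P = ∏ (nonzeroPart ∘ element)

  -- For q = 2 this fails at y = 0, where 0 ^ 0 = 1.
  ^[q∸2]≡⁻¹ : 2 < q → ∀ y → y ^ (q ∸ 2) ≡ y ⁻¹
  ^[q∸2]≡⁻¹ 2<q y with y ≟ 0#
  ... | yes refl = trans (0^-≡0 (m<n⇒0<n∸m 2<q)) (sym 0⁻¹)
  ... | no y≢0   = sym (⁻¹-unique (*-cancelˡ y≢0 (begin
    y * (y * y ^ (q ∸ 2)) ≡⟨ ^-peel₂ y (<⇒≤ 2<q) ⟨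
    y ^ q                 ≡⟨ fermat y≢0 ⟩
    y                     ≡⟨ *-identityʳ y ⟨
    y * 1#                ∎)))

  map-transp : ∀ {f : Carrier → Carrier} → Injective _≡_ _≡_ f →
               ∀ c x → Maybe.map f (transp c x) ≡ transp (f c) (Maybe.map f x)
  map-transp {f} f-inj c nothing = refl
  map-transp {f} f-inj c (just d) with d ≟ c | f d ≟ f c
  ... | yes _   | yes _    = refl
  ... | yes d≡c | no fd≢fc = ⊥-elim (fd≢fc (cong f d≡c))
  ... | no d≢c  | yes fd≡fc = ⊥-elim (d≢c (f-inj fd≡fc))
  ... | no _    | no _     = refl

  map-transps : ∀ {f : Carrier → Carrier} → Injective _≡_ _≡_ f →
                ∀ {k} (cs : Vec Carrier k) x → Maybe.map f (transps cs x) ≡ transps (Vec.map f cs) (Maybe.map f x)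
  map-transps f-inj []       x = refl
  map-transps f-inj (c ∷ cs) x = trans (map-transp f-inj c (transps cs x)) (cong (transp _) (map-transps f-inj cs x))

  -- The point [n : d] of P¹, with the junk value [0 : 0] = ∞.
  ratio : Carrier → Carrier → P1
  ratio n d with d ≟ 0#
  ... | yes _ = ∞
  ... | no  _ = just (n * d ⁻¹)

  linearForm : Carrier → Carrier → P1 → Carrier
  linearForm α β nothing  = α
  linearForm α β (just c) = α * c + β

  mobius≡ratio : ∀ α β γ δ x → mobius α β γ δ x ≡ ratio (linearForm α β x) (linearForm γ δ x)
  mobius≡ratio α β γ δ nothing with γ ≟ 0#
  ... | yes _ = refl
  ... | no  _ = refl
  mobius≡ratio α β γ δ (just c) with (γ * c + δ) ≟ 0#
  ... | yes _ = refl
  ... | no  _ = refl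

  ratio-1 : ∀ n → ratio n 1# ≡ just n
  ratio-1 n with 1# ≟ 0#
  ... | yes 1≡0 = ⊥-elim (1≢0 1≡0)
  ... | no  _   = cong just (trans (cong (n *_) (⁻¹-unique (*-identityʳ 1#))) (*-identityʳ n))

  ratio-0 : ∀ n → ratio n 0# ≡ ∞
  ratio-0 n with 0# ≟ 0#
  ... | yes _  = refl
  ... | no 0≢0 = ⊥-elim (0≢0 refl)

  inv-ratio : ∀ {n d} → ¬ (n ≡ 0# × d ≡ 0#) → inv (ratio n d) ≡ ratio d n
  inv-ratio {n} {d} ≢00 with d ≟ 0#
  inv-ratio {n} {d} ≢00 | yes d≡0 with n ≟ 0#
  ... | yes n≡0 = ⊥-elim (≢00 (n≡0 , d≡0))
  ... | no  _   = cong just (sym (trans (cong (_* n ⁻¹) d≡0) (zeroˡ (n ⁻¹))))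
  inv-ratio {n} {d} ≢00 | no d≢0 with (n * d ⁻¹) ≟ 0# | n ≟ 0#
  ... | yes _      | yes _   = refl
  ... | yes nd⁻¹≡0 | no n≢0  = ⊥-elim (*-≢0 n≢0 (⁻¹-≢0 d≢0) nd⁻¹≡0)
  ... | no nd⁻¹≢0  | yes n≡0 = ⊥-elim (nd⁻¹≢0 (trans (cong (_* d ⁻¹) n≡0) (zeroˡ (d ⁻¹))))
  ... | no _       | no n≢0  = cong just (begin
    (n * d ⁻¹) ⁻¹     ≡⟨ ⁻¹-distrib-* n≢0 (⁻¹-≢0 d≢0) ⟩
    n ⁻¹ * d ⁻¹ ⁻¹    ≡⟨ cong (n ⁻¹ *_) (⁻¹-involutive d) ⟩
    n ⁻¹ * d          ≡⟨ *-comm (n ⁻¹) d ⟩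
    d * n ⁻¹          ∎)

  add-ratio : ∀ a n d → add a (ratio n d) ≡ ratio (n + a * d) d
  add-ratio a n d with d ≟ 0#
  ... | yes _   = refl
  ... | no d≢0  = cong just (begin
    n * d ⁻¹ + a             ≡⟨ cong (n * d ⁻¹ +_) (trans (cong (a *_) (inverse d d≢0)) (*-identityʳ a)) ⟨
    n * d ⁻¹ + a * (d * d ⁻¹) ≡⟨ cong (n * d ⁻¹ +_) (*-assoc a d (d ⁻¹)) ⟨
    n * d ⁻¹ + a * d * d ⁻¹  ≡⟨ distribʳ (d ⁻¹) n (a * d) ⟨
    (n + a * d) * d ⁻¹       ∎)

  linearForm-add : ∀ a α β γ δ x →
                   linearForm γ δ x + a * linearForm α β x ≡ linearForm (γ + a * α) (δ + a * β) x
  linearForm-add a α β γ δ nothing  = refl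
  linearForm-add a α β γ δ (just c) =
    solve 6 (λ a α β γ δ c → γ :* c :+ δ :+ a :* (α :* c :+ β) := (γ :+ a :* α) :* c :+ (δ :+ a :* β))
          refl a α β γ δ c

  -- α (γc + δ) − γ (αc + β) = αδ − βγ, so both forms vanishing at x forces the determinant to vanish.
  linearForms-nonvanishing : ∀ {α β γ δ} → ¬ (α * δ - β * γ ≡ 0#) →
                             ∀ x → ¬ (linearForm α β x ≡ 0# × linearForm γ δ x ≡ 0#)
  linearForms-nonvanishing {α} {β} {γ} {δ} det≢0 x (N≡0 , D≡0) = det≢0 (x≈y⇒x∙y⁻¹≈ε (αδ≡βγ x N≡0 D≡0))
    where
    αδ≡βγ : ∀ x → linearForm α β x ≡ 0# → linearForm γ δ x ≡ 0# → α * δ ≡ β * γ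
    αδ≡βγ nothing α≡0 γ≡0 = begin
      α * δ   ≡⟨ cong (_* δ) α≡0 ⟩
      0# * δ  ≡⟨ zeroˡ δ ⟩
      0#      ≡⟨ zeroʳ β ⟨
      β * 0#  ≡⟨ cong (β *_) γ≡0 ⟨
      β * γ   ∎
    αδ≡βγ (just c) N≡0 D≡0 = begin
      α * δ                       ≡⟨ +-identityʳ (α * δ) ⟨
      α * δ + 0#                  ≡⟨ cong (α * δ +_) (trans (sym (zeroʳ γ)) (cong (γ *_) (sym N≡0))) ⟩
      α * δ + γ * (α * c + β)     ≡⟨ solve 5 (λ α β γ δ c → α :* δ :+ γ :* (α :* c :+ β) := α :* (γ :* c :+ δ) :+ β :* γ)
                                           refl α β γ δ c ⟩
      α * (γ * c + δ) + β * γ     ≡⟨ cong (λ t → α * t + β * γ) D≡0 ⟩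
      α * 0# + β * γ              ≡⟨ cong (_+ β * γ) (zeroʳ α) ⟩
      0# + β * γ                  ≡⟨ +-identityˡ (β * γ) ⟩
      β * γ                       ∎

  det-add∘inv : ∀ a {α β γ δ} → ¬ (α * δ - β * γ ≡ 0#) → ¬ ((γ + a * α) * β - (δ + a * β) * α ≡ 0#)
  det-add∘inv a {α} {β} {γ} {δ} det≢0 det′≡0 = det≢0 (x≈y⇒x∙y⁻¹≈ε (begin
    α * δ  ≡⟨ *-comm α δ ⟩
    δ * α  ≡⟨ ∙-cancelʳ (a * α * β) (δ * α) (γ * β) δα+aαβ≡γβ+aαβ ⟩
    γ * β  ≡⟨ *-comm γ β ⟩
    β * γ  ∎))
    where
    δα+aαβ≡γβ+aαβ : δ * α + a * α * β ≡ γ * β + a * α * β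
    δα+aαβ≡γβ+aαβ = begin
      δ * α + a * α * β  ≡⟨ solve 4 (λ a α β δ → δ :* α :+ a :* α :* β := (δ :+ a :* β) :* α) refl a α β δ ⟩
      (δ + a * β) * α    ≡⟨ x-y≡0⇒x≡y det′≡0 ⟨
      (γ + a * α) * β    ≡⟨ solve 4 (λ a α β γ → (γ :+ a :* α) :* β := γ :* β :+ a :* α :* β) refl a α β γ ⟩
      γ * β + a * α * β  ∎

  add∘inv∘mobius : ∀ a {α β γ δ} → ¬ (α * δ - β * γ ≡ 0#) →
                   ∀ x → add a (inv (mobius α β γ δ x)) ≡ mobius (γ + a * α) (δ + a * β) α β x
  add∘inv∘mobius a {α} {β} {γ} {δ} det≢0 x = begin
    add a (inv (mobius α β γ δ x))  ≡⟨ cong (add a ∘ inv) (mobius≡ratio α β γ δ x) ⟩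
    add a (inv (ratio N D))         ≡⟨ cong (add a) (inv-ratio (linearForms-nonvanishing det≢0 x)) ⟩
    add a (ratio D N)               ≡⟨ add-ratio a D N ⟩
    ratio (D + a * N) N             ≡⟨ cong (λ t → ratio t N) (linearForm-add a α β γ δ x) ⟩
    ratio (linearForm (γ + a * α) (δ + a * β) x) N ≡⟨ mobius≡ratio (γ + a * α) (δ + a * β) α β x ⟨
    mobius (γ + a * α) (δ + a * β) α β x ∎
    where
    N D : Carrier
    N = linearForm α β x
    D = linearForm γ δ x

  DegreeOne-id : DegreeOne id
  DegreeOne-id = 1# , 0# , 0# , 1# , det≢0 , λ x → sym (trans (mobius≡ratio 1# 0# 0# 1# x) (ratio-identity x))
    where
    det≢0 : ¬ (1# * 1# - 0# * 0# ≡ 0#)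
    det≢0 det≡0 = 1≢0 (begin
      1#                 ≡⟨ +-identityʳ 1# ⟨
      1# + 0#            ≡⟨ cong₂ _+_ (*-identityˡ 1#) (trans (cong -_ (zeroˡ 0#)) ε⁻¹≈ε) ⟨
      1# * 1# - 0# * 0#  ≡⟨ det≡0 ⟩
      0#                 ∎)
    ratio-identity : ∀ x → ratio (linearForm 1# 0# x) (linearForm 0# 1# x) ≡ x
    ratio-identity nothing  = ratio-0 1#
    ratio-identity (just c) = trans (cong₂ ratio (trans (+-identityʳ _) (*-identityˡ c))
                                                 (trans (cong (_+ 1#) (zeroˡ c)) (+-identityˡ 1#)))
                                    (ratio-1 c)

  DegreeOne-add∘inv : ∀ a {f} → DegreeOne f → DegreeOne (add a ∘ inv ∘ f)
  DegreeOne-add∘inv a {f} (α , β , γ , δ , det≢0 , f≗mobius) =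
    γ + a * α , δ + a * β , α , β , det-add∘inv a det≢0 ,
    λ x → trans (cong (add a ∘ inv) (f≗mobius x)) (add∘inv∘mobius a det≢0 x)

  DegreeOne-μ : ∀ {k} (as : Vec Carrier k) → DegreeOne (μ as)
  DegreeOne-μ []       = DegreeOne-id
  DegreeOne-μ (a ∷ as) = DegreeOne-add∘inv a (DegreeOne-μ as)

  module _ (2<q : 2 < q) where

    shiftInvert : Carrier → Carrier → Carrier
    shiftInvert b e = (e - b) ^ (q ∸ 2)

    shiftInvert-injective : ∀ b → Injective _≡_ _≡_ (shiftInvert b)
    shiftInvert-injective b {x} {y} eq = x-z≡y-z⇒x≡y b (⁻¹-injective (begin
      (x - b) ⁻¹          ≡⟨ ^[q∸2]≡⁻¹ 2<q (x - b) ⟨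
      shiftInvert b x     ≡⟨ eq ⟩
      shiftInvert b y     ≡⟨ ^[q∸2]≡⁻¹ 2<q (y - b) ⟩
      (y - b) ⁻¹          ∎))

    powq2∘sub≡map : ∀ b x → powq2 (sub b x) ≡ Maybe.map (shiftInvert b) x
    powq2∘sub≡map b nothing  = refl
    powq2∘sub≡map b (just _) = refl

    powq2∘sub∘transps : ∀ b {k} (cs : Vec Carrier k) x →
                        powq2 (sub b (transps cs x)) ≡ transps (Φ (b ∷ cs)) (powq2 (sub b x))
    powq2∘sub∘transps b cs x = begin
      powq2 (sub b (transps cs x))                      ≡⟨ powq2∘sub≡map b (transps cs x) ⟩
      Maybe.map (shiftInvert b) (transps cs x)          ≡⟨ map-transps (shiftInvert-injective b) cs x ⟩
      transps (Φ (b ∷ cs)) (Maybe.map (shiftInvert b) x) ≡⟨ cong (transps (Φ (b ∷ cs))) (powq2∘sub≡map b x) ⟨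
      transps (Φ (b ∷ cs)) (powq2 (sub b x))            ∎

    add∘inv∘powq2∘sub : ∀ b x → add b (inv (powq2 (sub b x))) ≡ transp b x
    add∘inv∘powq2∘sub b nothing  = cong just (+-identityˡ b)
    add∘inv∘powq2∘sub b (just d) rewrite ^[q∸2]≡⁻¹ 2<q (d - b) with ((d - b) ⁻¹) ≟ 0# | d ≟ b
    ... | yes _          | yes _    = refl
    ... | yes [d-b]⁻¹≡0 | no d≢b   = ⊥-elim (d≢b (x-y≡0⇒x≡y (⁻¹-injective (trans [d-b]⁻¹≡0 (sym 0⁻¹)))))
    ... | no [d-b]⁻¹≢0  | yes refl = ⊥-elim ([d-b]⁻¹≢0 (trans (cong _⁻¹ (x≈y⇒x∙y⁻¹≈ε refl)) 0⁻¹))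
    ... | no _           | no _     = cong just (trans (cong (_+ b) (⁻¹-involutive (d - b))) (x-y+y≡x d b))

    transps≡μ∘tailComp : ∀ {k} (bs : Vec Carrier k) x → transps bs x ≡ μ (G bs) (tailComp (G bs) x)
    transps≡μ∘tailComp []       x = refl
    transps≡μ∘tailComp (b ∷ bs) x = begin
      transp b (transps bs x)                                       ≡⟨ add∘inv∘powq2∘sub b (transps bs x) ⟨
      add b (inv (powq2 (sub b (transps bs x))))                    ≡⟨ cong (add b ∘ inv) (powq2∘sub∘transps b bs x) ⟩
      add b (inv (transps (Φ (b ∷ bs)) (powq2 (sub b x))))          ≡⟨ cong (add b ∘ inv) (transps≡μ∘tailComp (Φ (b ∷ bs)) _) ⟩
      μ (G (b ∷ bs)) (tailComp (G (b ∷ bs)) x)                      ∎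

theorem3p3 : (q : ℕ) (F : FiniteField q) → 2 < q →
    let open FiniteField F in
    (k : ℕ) (b : Vec Carrier (suc k)) →
    DegreeOne (μ (G b)) ×
    (∀ x → transps b x ≡ μ (G b) (tailComp (G b) x))
theorem3p3 q F 2<q k b = DegreeOne-μ F (FiniteField.G F b) , transps≡μ∘tailComp F 2<q b
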